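{- Let $G$ be a graph on $n$ vertices with $\mathrm{Sp}^p_\alpha(G)=\{a_1,a_2,\dots,a_t\}$, $a_1<a_2<\cdots<a_t$, and let $\alpha_1<\cdots<\alpha_{t-1}$ be its critical values. Then for each $i$ there exists a $\mathrm{pd}_{\alpha_i}$-set $S_i\subseteq V$ such that $\alpha_i=\frac{|N[S_i]|}{n}$.
   Context: All graphs are finite and simple. For a graph $G=(V,E)$ and $S\subseteq V$, $N[S]$ denotes the closed neighbourhood of $S$. For $0<\alpha\le 1$, a set $S\subseteq V$ is an $\alpha$-partial dominating set if $|N[S]|\ge \alpha|V|$; $\mathrm{pd}_\alpha(G)$ is the minimum size of an $\alpha$-partial dominating set, and a $\mathrm{pd}_\alpha$-set is an $\alpha$-partial dominating set of size $\mathrm{pd}_\alpha(G)$. The spectrum is $\mathrm{Sp}^p_\alpha(G)=\{\mathrm{pd}_\alpha(G):\alpha\in(0,1]\}$. The critical values are the numbers $\alpha_1<\dots<\alpha_{t-1}$ in $(0,1)$ such that $\mathrm{pd}_\alpha(G)=a_1$ for $\alpha\in(0,\alpha_1]$, $\mathrm{pd}_\alpha(G)=a_{i+1}$ for $\alpha\in(\alpha_i,\alpha_{i+1}]$ ($1\le i\le t-2$), and $\mathrm{pd}_\alpha(G)=a_t$ for $\alpha\in(\alpha_{t-1},1]$; in particular $\mathrm{pd}_{\alpha_i}(G)=a_i$.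
   Formalization: The parameter α, both in the spectrum and in the description of the critical values, ranges over the rationals in (0,1], and the critical values $\alpha_i$ are rational. -}

module Defs where

open import Data.Nat using (ℕ; zero; suc; _≤_; _<_)
open import Data.Bool using (Bool; true; false; _∧_; _∨_)
open import Data.Fin using (Fin; zero; suc; _≟_) renaming (_<_ to _<ᶠ_)
open import Data.Fin.Subset using (Subset; ∣_∣)
open import Data.Vec using (lookup; tabulate)
open import Data.Integer using (+_)
open import Data.Rational using (ℚ; _/_; 0ℚ; 1ℚ; _*_) renaming (_≤_ to _≤ℚ_; _<_ to _<ℚ_)
open import Data.Product using (Σ; ∃; _×_; _,_)
open import Relation.Nullary using (does)
open import Relation.Binary.PropositionalEquality using (_≡_)

record Graph (n : ℕ) : Set where
  field
    adj    : Fin n → Fin n → Bool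
    sym    : ∀ u v → adj u v ≡ adj v u
    irrefl : ∀ v → adj v v ≡ false
open Graph public

anyᶠ : {n : ℕ} → (Fin n → Bool) → Bool
anyᶠ {zero}  f = false
anyᶠ {suc n} f = f zero ∨ anyᶠ (λ i → f (suc i))

N[_]_ : {n : ℕ} → Graph n → Subset n → Subset n
N[ G ] S = tabulate λ v → anyᶠ (λ u → lookup S u ∧ (does (u ≟ v) ∨ adj G u v))

ℕ→ℚ : ℕ → ℚ
ℕ→ℚ k = (+ k) / 1

IsPartialDom : {n : ℕ} → Graph n → ℚ → Subset n → Set
IsPartialDom {n} G α S = α * ℕ→ℚ n ≤ℚ ℕ→ℚ ∣ N[ G ] S ∣

IsPd : {n : ℕ} → Graph n → ℚ → ℕ → Set
IsPd {n} G α k =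
  (Σ (Subset n) λ S → IsPartialDom G α S × ∣ S ∣ ≡ k)
  × (∀ (S : Subset n) → IsPartialDom G α S → k ≤ ∣ S ∣)

IsPdSet : {n : ℕ} → Graph n → ℚ → Subset n → Set
IsPdSet G α S = IsPartialDom G α S × IsPd G α ∣ S ∣

-- Given critical values c : Fin m → ℚ, the j-th interval (j : Fin (suc m))
-- is (lo c j , hi c j], with lo c 0 = 0, lo c (j+1) = c j,
-- hi c j = c j for j < m and hi c m = 1.
lo : {m : ℕ} → (Fin m → ℚ) → Fin (suc m) → ℚ
lo c zero    = 0ℚ
lo c (suc k) = c k

hi : {m : ℕ} → (Fin m → ℚ) → Fin (suc m) → ℚ
hi {zero}  c zero    = 1ℚ
hi {suc m} c zero    = c zero
hi {suc m} c (suc k) = hi (λ i → c (suc i)) k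

IsSpectrum : {n m : ℕ} → Graph n → (Fin (suc m) → ℕ) → Set
IsSpectrum {n} {m} G a =
  (∀ (α : ℚ) (k : ℕ) → 0ℚ <ℚ α → α ≤ℚ 1ℚ → IsPd G α k → ∃ λ j → a j ≡ k)
  × (∀ (j : Fin (suc m)) → ∃ λ α → 0ℚ <ℚ α × α ≤ℚ 1ℚ × IsPd G α (a j))

StrictIncℕ : {m : ℕ} → (Fin m → ℕ) → Set
StrictIncℕ a = ∀ i j → i <ᶠ j → a i < a j

StrictIncℚ : {m : ℕ} → (Fin m → ℚ) → Set
StrictIncℚ c = ∀ i j → i <ᶠ j → c i <ℚ c j

IsCritical : {n m : ℕ} → Graph n → (Fin (suc m) → ℕ) → (Fin m → ℚ) → Set
IsCritical {n} {m} G a c =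
  StrictIncℚ c
  × (∀ i → 0ℚ <ℚ c i × c i <ℚ 1ℚ)
  × (∀ (j : Fin (suc m)) (α : ℚ) → lo c j <ℚ α → α ≤ℚ hi c j → IsPd G α (a j))

-- Let S be a pd_{αᵢ}-set; it has size aᵢ and |N[S]| ≥ αᵢ n.
-- Suppose the inequality were strict.  Then S still partially dominates
-- for every β slightly above αᵢ, in particular for some β in the next
-- interval (αᵢ, αᵢ₊₁] (or (αᵢ, 1]), where pd_β(G) = aᵢ₊₁ > aᵢ = |S|;
-- this contradicts the minimality in the definition of pd_β.
module Submission where

open import Defs
open import Data.Nat using (ℕ; suc; zero; s≤s; z≤n) renaming (_≤_ to _≤ℕ_)
import Data.Nat.Properties as ℕ
open import Data.Fin using (Fin; zero; suc; inject₁; toℕ)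
import Data.Fin.Properties as Fin
open import Data.Fin.Subset using (Subset; ∣_∣)
open import Data.Vec using ([])
open import Data.Rational using (ℚ; _*_; _≤_; _<_; 0ℚ; 1ℚ; _⊓_; 1/_; Positive)
open import Data.Rational.Properties
open import Data.Product using (Σ; _×_; _,_; proj₁; proj₂)
open import Data.Sum using (inj₁; inj₂)
open import Relation.Nullary using (¬_)
open import Relation.Binary.PropositionalEquality
  using (_≡_; refl; cong; subst; module ≡-Reasoning)
  renaming (sym to ≡-sym)

<-⊓ : {p q r : ℚ} → p < q → p < r → p < q ⊓ r
<-⊓ {p} {q} {r} p<q p<r with ⊓-sel q r
... | inj₁ q⊓r≡q = subst (p <_) (≡-sym q⊓r≡q) p<q
... | inj₂ q⊓r≡r = subst (p <_) (≡-sym q⊓r≡r) p<r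

≤∧≮⇒≡ : {p q : ℚ} → p ≤ q → ¬ p < q → p ≡ q
≤∧≮⇒≡ p≤q p≮q = ≤-antisym p≤q (≮⇒≥ p≮q)

-- Room above x: if x < h and x r < y with r > 0, some β ∈ (x, h] still
-- satisfies β r ≤ y; take β = min (y / r) h.
room-above : (x h y r : ℚ) → Positive r → x < h → x * r < y
  → Σ ℚ λ β → x < β × β ≤ h × β * r ≤ y
room-above x h y r r>0 x<h xr<y = y/r ⊓ h , <-⊓ x<y/r x<h , p⊓q≤q y/r h , βr≤y
  where
  instance
    _ = pos⇒nonZero r {{r>0}}
    _ = pos⇒nonNeg r {{r>0}}
  y/r : ℚ
  y/r = y * 1/ r
  y/r*r≡y : y/r * r ≡ y
  y/r*r≡y = begin
    y * 1/ r * r    ≡⟨ *-assoc y (1/ r) r ⟩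
    y * (1/ r * r)  ≡⟨ cong (y *_) (*-inverseˡ r) ⟩
    y * 1ℚ          ≡⟨ *-identityʳ y ⟩
    y               ∎
    where open ≡-Reasoning
  x<y/r : x < y/r
  x<y/r = *-cancelʳ-<-nonNeg r (subst (x * r <_) (≡-sym y/r*r≡y) xr<y)
  βr≤y : (y/r ⊓ h) * r ≤ y
  βr≤y = ≤-trans (*-monoʳ-≤-nonNeg r (p⊓q≤p y/r h)) (≤-reflexive y/r*r≡y)

hi-inject₁ : {m : ℕ} (c : Fin m → ℚ) (i : Fin m) → hi c (inject₁ i) ≡ c i
hi-inject₁ {suc m} c zero    = refl
hi-inject₁ {suc m} c (suc i) = hi-inject₁ (λ k → c (suc k)) i

lo-inject₁< : {m : ℕ} (c : Fin m → ℚ) → StrictIncℚ c → (∀ i → 0ℚ < c i)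
  → (i : Fin m) → lo c (inject₁ i) < c i
lo-inject₁< c inc pos zero    = pos zero
lo-inject₁< c inc pos (suc i) = inc (inject₁ i) (suc i) (Fin.≤̄⇒inject₁< Fin.≤-refl)

-- hi c j is either 1 or a critical value c k with k ≥ j, so anything below
-- 1 and below all those c k is below hi c j.
below-hi : {m : ℕ} (c : Fin m → ℚ) (j : Fin (suc m)) (x : ℚ) → x < 1ℚ
  → (∀ k → toℕ j ≤ℕ toℕ k → x < c k) → x < hi c j
below-hi {zero}  c zero    x x<1 x<c = x<1
below-hi {suc m} c zero    x x<1 x<c = x<c zero z≤n
below-hi {suc m} c (suc j) x x<1 x<c =
  below-hi (λ k → c (suc k)) j x x<1 (λ k j≤k → x<c (suc k) (s≤s j≤k))

c<hi-suc : {m : ℕ} (c : Fin m → ℚ) → StrictIncℚ c → (∀ i → c i < 1ℚ)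
  → (i : Fin m) → c i < hi c (suc i)
c<hi-suc c inc <1 i = below-hi c (suc i) (c i) (<1 i) (λ k i<k → inc i k i<k)

-- Tightness: if S is α-dominating but β-dominating for no β ∈ (α, γ],
-- then S covers exactly α n vertices.  (For n = 0 both sides vanish;
-- otherwise strict inequality would leave room for such a β.)
exact-ratio : {n : ℕ} (G : Graph n) (α γ : ℚ) (S : Subset n) → α < γ
  → IsPartialDom G α S
  → (∀ β → α < β → β ≤ γ → ¬ IsPartialDom G β S)
  → α * ℕ→ℚ n ≡ ℕ→ℚ ∣ N[ G ] S ∣
exact-ratio {zero}  G α γ [] α<γ dom notDom = *-zeroʳ α
exact-ratio {suc k} G α γ S  α<γ dom notDom = ≤∧≮⇒≡ dom strict-impossible
  where
  strict-impossible : ¬ α * ℕ→ℚ (suc k) < ℕ→ℚ ∣ N[ G ] S ∣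
  strict-impossible strict = refute
    (room-above α γ (ℕ→ℚ ∣ N[ G ] S ∣) (ℕ→ℚ (suc k)) (normalize-pos (suc k) 1) α<γ strict)
    where
    refute : ¬ (Σ ℚ λ β → α < β × β ≤ γ × IsPartialDom G β S)
    refute (β , α<β , β≤γ , domβ) = notDom β α<β β≤γ domβ

-- A pd_{c i}-set S of size a_i comes from the interval
-- ending at c i; on the next interval pd = a_{i+1} > |S|, so S dominates
-- for no β there, and `exact-ratio` gives c i · n = |N[S]|.
mainTheorem20 : (n : ℕ) (G : Graph n) (m : ℕ) (a : Fin (suc m) → ℕ) (c : Fin m → ℚ)
    → StrictIncℕ a → IsSpectrum G a → IsCritical G a c
    → (i : Fin m) → Σ (Subset n) λ S → IsPdSet G (c i) S × c i * ℕ→ℚ n ≡ ℕ→ℚ ∣ N[ G ] S ∣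
mainTheorem20 n G m a c incA _ (incC , bounds , pdOn) i =
  S , (domS , subst (IsPd G (c i)) (≡-sym |S|≡aᵢ) pdᵢ) ,
  exact-ratio G (c i) (hi c (suc i)) S (c<hi-suc c incC (λ k → proj₂ (bounds k)) i) domS notDom
  where
  pdᵢ : IsPd G (c i) (a (inject₁ i))
  pdᵢ = pdOn (inject₁ i) (c i)
          (lo-inject₁< c incC (λ k → proj₁ (bounds k)) i)
          (≤-reflexive (≡-sym (hi-inject₁ c i)))
  S : Subset n
  S = proj₁ (proj₁ pdᵢ)
  domS : IsPartialDom G (c i) S
  domS = proj₁ (proj₂ (proj₁ pdᵢ))
  |S|≡aᵢ : ∣ S ∣ ≡ a (inject₁ i)
  |S|≡aᵢ = proj₂ (proj₂ (proj₁ pdᵢ))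
  notDom : ∀ β → c i < β → β ≤ hi c (suc i) → ¬ IsPartialDom G β S
  notDom β ci<β β≤hi domβ = ℕ.<⇒≱ (incA (inject₁ i) (suc i) (Fin.≤̄⇒inject₁< Fin.≤-refl))
    (subst (a (suc i) ≤ℕ_) |S|≡aᵢ (proj₂ (pdOn (suc i) β ci<β β≤hi) S domβ))
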